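{- For every dag $G$ and number of stones $m$ as described in the context, the clause set $\mathrm{Stone}(G,m)$ has a regWRTL refutation, and hence a pool resolution refutation, of size $O(Nm^3)$, where $N$ is the number of vertices of $G$ (the constant in the $O$ is absolute).
   Context: A literal is a propositional variable $x$ or its negation $\overline{x}$; a clause is a set of literals, read as their disjunction; a set of clauses is read as their conjunction. Stone principle: Let $G=(V,E)$ be a directed acyclic graph with vertices $V=\{1,\dots,N\}$ and a single sink, vertex $1$, such that every non-source vertex has in-degree exactly $2$, edges go from larger to smaller numbers (if $(i',i)\in E$ then $i'>i$), and the source vertices are exactly $n+1,\dots,N$ for some $n$. Let $m\ge N$. The clause set $\mathrm{Stone}(G,m)$ uses variables $p_{i,j}$ ($i\in V$, $1\le j\le m$; "vertex $i$ is pebbled by stone $j$") and $r_j$ ("stone $j$ is red") and consists of: (1) $\bigvee_{j=1}^m p_{i,j}$ for each vertex $i$; (2) $\overline{p}_{i,j}\lor r_j$ for each source vertex $i$ and each $j$; (3) $\overline{p}_{1,j}\lor\overline{r}_j$ for each $j$; (4) $\overline{p}_{i',j'}\lor\overline{r}_{j'}\lor\overline{p}_{i'',j''}\lor\overline{r}_{j''}\lor\overline{p}_{i,j}\lor r_j$ whenever $i',i''$ are the two predecessors of $i$ (i.e. $(i',i),(i'',i)\in E$) and $j\notin\{j',j''\}$. Inference rules: Given clauses $A,B$ and a variable $x$ with $\overline{x}\notin A$, $x\notin B$: the resolution rule (requires $x\in A,\overline{x}\in B$) infers $(A\setminus\{x\})\cup(B\setminus\{\overline{x}\})$; the degenerate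 resolution rule infers this same clause if $x\in A$ and $\overline x\in B$, infers $B$ if $x\in A,\overline{x}\notin B$, infers $A$ if $x\notin A,\overline{x}\in B$, and otherwise infers either $A$ or $B$; the w-resolution rule always infers $(A\setminus\{x\})\cup(B\setminus\{\overline{x}\})$. $x$ is the resolution variable. Given a tree $T$, the postorder $<_T$: if $v$ is in the subtree of the left child of $u$ and $w$ in the subtree of the right child of $u$, then $v<_T w<_T u$. A regRTL derivation of $C$ from $\Gamma$ is a tree in which each internal node is labeled by a clause and a variable, its clause being obtained by resolution on that variable from its two children's clauses; each leaf is labeled by a clause of $\Gamma$ or by a clause (a lemma) appearing earlier in the tree in the postorder $<_T$; the tree is regular (no variable is used as resolution variable twice on any root-to-leaf path); and the root is labeled $C$. It is a refutation if $C$ is the empty clause. A regWRTL derivation is the same but with w-resolution inferences allowed; a pool resolution derivation is the same but with degenerate resolution inferences allowed. The size of a derivation is its number of clauses. -}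

module Defs where

open import Data.Nat using (ℕ; zero; suc; _+_; _*_; _^_; _≤_; _<_)
open import Data.List using (List; []; _∷_; _++_; map; upTo)
open import Data.List.Membership.Propositional using (_∈_; _∉_)
open import Data.Product using (Σ; _×_; _,_; ∃-syntax)
open import Data.Sum using (_⊎_)
open import Relation.Binary.PropositionalEquality using (_≡_; _≢_)
open import Relation.Nullary using (¬_)
open import Data.Unit using (⊤)

data Var : Set where
  p : ℕ → ℕ → Var    -- p i j : vertex i is pebbled by stone j
  r : ℕ → Var        -- r j   : stone j is red

data Lit : Set where
  pos : Var → Lit
  neg : Var → Lit

-- A clause is a finite set of literals, represented by a list and
-- always compared up to membership (order / repetitions irrelevant).
Clause : Set
Clause = List Lit

_≋_ : Clause → Clause → Set
C ≋ D = (∀ l → l ∈ C → l ∈ D) × (∀ l → l ∈ D → l ∈ C)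

IsEmpty : Clause → Set
IsEmpty C = ∀ l → l ∉ C

Resolvent : Clause → Clause → Var → Clause → Set
Resolvent A B x C =
  ∀ l → (l ∈ C → (l ∈ A × l ≢ pos x) ⊎ (l ∈ B × l ≢ neg x))
      × ((l ∈ A × l ≢ pos x) ⊎ (l ∈ B × l ≢ neg x) → l ∈ C)

-- An inference rule: Rule A B x C  means  "C is inferred from A, B on x".
Rule : Set₁
Rule = Clause → Clause → Var → Clause → Set

ResRule : Rule
ResRule A B x C =
  neg x ∉ A × pos x ∉ B × pos x ∈ A × neg x ∈ B × Resolvent A B x C

WResRule : Rule
WResRule A B x C = neg x ∉ A × pos x ∉ B × Resolvent A B x C

DegResRule : Rule
DegResRule A B x C = neg x ∉ A × pos x ∉ B ×
  ( (pos x ∈ A × neg x ∈ B × Resolvent A B x C)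
  ⊎ (pos x ∈ A × neg x ∉ B × C ≋ B)
  ⊎ (pos x ∉ A × neg x ∈ B × C ≋ A)
  ⊎ (pos x ∉ A × neg x ∉ B × (C ≋ A ⊎ C ≋ B)) )

RegWRTLRule : Rule
RegWRTLRule A B x C = ResRule A B x C ⊎ WResRule A B x C

PoolRule : Rule
PoolRule A B x C = ResRule A B x C ⊎ DegResRule A B x C

data Tree : Set where
  leaf : Clause → Tree
  node : Clause → Var → Tree → Tree → Tree   -- clause, resolution variable, left, right

label : Tree → Clause
label (leaf C)       = C
label (node C _ _ _) = C

postorder : Tree → List Clause
postorder (leaf C)       = C ∷ []
postorder (node C _ t u) = postorder t ++ postorder u ++ C ∷ []

size : Tree → ℕ
size (leaf _)       = 1
size (node _ _ t u) = suc (size t + size u)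

ClauseSet : Set₁
ClauseSet = Clause → Set

-- The list 'earlier' holds the labels of all nodes strictly before the
-- current subtree in the postorder <_T.  A leaf is labelled by a clause
-- of Γ or by a lemma: a clause labelling an earlier node.
Wf : Rule → ClauseSet → List Clause → Tree → Set
Wf R Γ earlier (leaf C) =
  (∃[ D ] (Γ D × C ≋ D)) ⊎ (∃[ D ] (D ∈ earlier × C ≋ D))
Wf R Γ earlier (node C x t u) =
  (R (label t) (label u) x C ⊎ R (label u) (label t) x C)
  × Wf R Γ earlier t
  × Wf R Γ (earlier ++ postorder t) u

Regular' : List Var → Tree → Set
Regular' used (leaf _)       = ⊤
Regular' used (node _ x t u) = x ∉ used × Regular' (x ∷ used) t × Regular' (x ∷ used) u

Regular : Tree → Set
Regular = Regular' []

Refutation : Rule → ClauseSet → Tree → Set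
Refutation R Γ t = Wf R Γ [] t × Regular t × IsEmpty (label t)

RegWRTLRefutation : ClauseSet → Tree → Set
RegWRTLRefutation = Refutation RegWRTLRule

PoolRefutation : ClauseSet → Tree → Set
PoolRefutation = Refutation PoolRule

-- Vertices 1..N; non-source vertices are 1..n, each with exactly two
-- distinct predecessors pred₁ i, pred₂ i (edges (pred₁ i, i), (pred₂ i, i)),
-- which are larger than i; sources (in-degree 0) are n+1..N;
-- vertex 1 is the unique sink (every other vertex has an out-edge).

record StoneDag : Set where
  field
    N      : ℕ
    n      : ℕ
    pred₁  : ℕ → ℕ
    pred₂  : ℕ → ℕ
    1≤N    : 1 ≤ N
    n≤N    : n ≤ N
    pred₁-ok : ∀ i → 1 ≤ i → i ≤ n → i < pred₁ i × pred₁ i ≤ N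
    pred₂-ok : ∀ i → 1 ≤ i → i ≤ n → i < pred₂ i × pred₂ i ≤ N
    pred-distinct : ∀ i → 1 ≤ i → i ≤ n → pred₁ i ≢ pred₂ i
    single-sink : ∀ v → 2 ≤ v → v ≤ N →
      ∃[ i ] (1 ≤ i × i ≤ n × (v ≡ pred₁ i ⊎ v ≡ pred₂ i))

open StoneDag public

stones : ℕ → List ℕ
stones m = map suc (upTo m)

data Stone (G : StoneDag) (m : ℕ) : ClauseSet where
  cover : ∀ i → 1 ≤ i → i ≤ N G →
    Stone G m (map (λ j → pos (p i j)) (stones m))
  source : ∀ i j → n G < i → i ≤ N G → 1 ≤ j → j ≤ m →
    Stone G m (neg (p i j) ∷ pos (r j) ∷ [])
  sink : ∀ j → 1 ≤ j → j ≤ m →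
    Stone G m (neg (p 1 j) ∷ neg (r j) ∷ [])
  pebble : ∀ i j j′ j″ → 1 ≤ i → i ≤ n G →
    1 ≤ j → j ≤ m → 1 ≤ j′ → j′ ≤ m → 1 ≤ j″ → j″ ≤ m →
    j ≢ j′ → j ≢ j″ →
    Stone G m (neg (p (pred₁ G i) j′) ∷ neg (r j′) ∷
               neg (p (pred₂ G i) j″) ∷ neg (r j″) ∷
               neg (p i j) ∷ pos (r j) ∷ [])

-- For every vertex u and stone j the clause p̄ᵤⱼ ∨ rⱼ is derivable: for a source it is an
-- axiom, and for a non-source v with predecessors v₁, v₂ it follows in O(m²) steps by resolving
-- away the cover clause of v₂ stone by stone, where the branch for stone c resolves away the
-- cover clause of v₁ against the pebbling clauses and the lemmas for v₁ and v₂.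
-- Regularity forbids reusing a derivation, but not a clause derived earlier in postorder.  So
-- the refutation runs along a spine carrying the cover clause of the sink, and for
-- v = n, …, 2 and every stone s it splices in a derivation of p̄ᵥₛ ∨ rₛ by two w-resolution
-- (respectively degenerate resolution) steps that leave the spine clause unchanged; later
-- derivations use p̄ᵥₛ ∨ rₛ as a lemma.  Finally the spine clause is resolved against p̄₁ⱼ,
-- obtained from the lemma for the sink and axiom (3), for j = 1, …, m.  This takes O(Nm)
-- derivations of size O(m²).

module Submission where

open import Level using (0ℓ)
open import Data.Nat using (ℕ; zero; suc; _+_; _*_; _^_; _∸_; _≤_; _<_; _≟_; _≤?_; z≤n; s≤s)
open import Data.Nat.Properties
open import Data.Nat.Tactic.RingSolver using (solve-∀)
open import Data.List using (List; []; _∷_; _++_; map; filter)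
open import Data.List.Membership.Propositional using (_∈_; _∉_)
open import Data.List.Membership.Propositional.Properties
  using (∈-++⁺ˡ; ∈-++⁺ʳ; ∈-++⁻; ∈-filter⁺; ∈-filter⁻; ∈-map⁺; ∈-map⁻; ∈-upTo⁺; ∈-upTo⁻)
import Data.List.Relation.Binary.Subset.Propositional.Properties as Subset
open import Data.List.Relation.Unary.All as All using (All; []; _∷_)
open import Data.List.Relation.Unary.Any using (here; there)
open import Data.Product using (Σ; _×_; _,_; ∃-syntax; proj₁; proj₂; uncurry)
open import Data.Sum using (_⊎_; inj₁; inj₂; [_,_])
open import Data.Empty using (⊥; ⊥-elim)
open import Data.Unit using (tt)
open import Function using (_∘_)
open import Relation.Binary.Definitions using (DecidableEquality)
open import Relation.Binary.PropositionalEquality using (_≡_; _≢_; refl; sym; trans; cong; subst)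
open import Relation.Nullary using (¬_; yes; no)
open import Relation.Nullary.Decidable using (¬?; map′; _×-dec_)
open import Relation.Unary using (Pred; _⊆_; _∪_; ｛_｝; ∅)

open import Defs

⟦_⟧ : {A : Set} → List A → Pred A 0ℓ
⟦ xs ⟧ = _∈ xs

var : Lit → Var
var (pos x) = x
var (neg x) = x

vertex-injective : ∀ {u u′ j j′} → p u j ≡ p u′ j′ → u ≡ u′
vertex-injective refl = refl

_≟ᵛ_ : DecidableEquality Var
p i j ≟ᵛ p i′ j′ = map′ (λ { (refl , refl) → refl }) (λ { refl → refl , refl }) (i ≟ i′ ×-dec j ≟ j′)
p _ _ ≟ᵛ r _    = no λ ()
r _ ≟ᵛ p _ _    = no λ ()
r j ≟ᵛ r j′     = map′ (cong r) (λ { refl → refl }) (j ≟ j′)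

_≟ˡ_ : DecidableEquality Lit
pos x ≟ˡ pos y = map′ (cong pos) (λ { refl → refl }) (x ≟ᵛ y)
pos _ ≟ˡ neg _ = no λ ()
neg _ ≟ˡ pos _ = no λ ()
neg x ≟ˡ neg y = map′ (cong neg) (λ { refl → refl }) (x ≟ᵛ y)

-- Opaque, so that in the lemmas below the arguments of `resolve A B x` can be inferred.
opaque
  resolve : Clause → Clause → Var → Clause
  resolve A B x = filter (λ l → ¬? (l ≟ˡ pos x)) A ++ filter (λ l → ¬? (l ≟ˡ neg x)) B

module _ {A B : Clause} {x : Var} where

  opaque
    unfolding resolve

    ∈-resolve⁺ˡ : ∀ {l} → l ∈ A → l ≢ pos x → l ∈ resolve A B x
    ∈-resolve⁺ˡ l∈A l≢x = ∈-++⁺ˡ (∈-filter⁺ (λ l → ¬? (l ≟ˡ pos x)) l∈A l≢x)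

    ∈-resolve⁺ʳ : ∀ {l} → l ∈ B → l ≢ neg x → l ∈ resolve A B x
    ∈-resolve⁺ʳ l∈B l≢x̄ = ∈-++⁺ʳ _ (∈-filter⁺ (λ l → ¬? (l ≟ˡ neg x)) l∈B l≢x̄)

    ∈-resolve⁻ : ∀ {l} → l ∈ resolve A B x → (l ∈ A × l ≢ pos x) ⊎ (l ∈ B × l ≢ neg x)
    ∈-resolve⁻ l∈C with ∈-++⁻ (filter (λ l → ¬? (l ≟ˡ pos x)) A) l∈C
    ... | inj₁ l∈A′ = inj₁ (∈-filter⁻ (λ l → ¬? (l ≟ˡ pos x)) l∈A′)
    ... | inj₂ l∈B′ = inj₂ (∈-filter⁻ (λ l → ¬? (l ≟ˡ neg x)) l∈B′)

  resolve-resolvent : Resolvent A B x (resolve A B x)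
  resolve-resolvent l = ∈-resolve⁻ , [ uncurry ∈-resolve⁺ˡ , uncurry ∈-resolve⁺ʳ ]

  resolve-⊆ : {P : Pred Lit 0ℓ} →
    (∀ {l} → l ∈ A → l ≢ pos x → P l) → (∀ {l} → l ∈ B → l ≢ neg x → P l) →
    ⟦ resolve A B x ⟧ ⊆ P
  resolve-⊆ fromA fromB l∈C with ∈-resolve⁻ l∈C
  ... | inj₁ (l∈A , l≢x) = fromA l∈A l≢x
  ... | inj₂ (l∈B , l≢x̄) = fromB l∈B l≢x̄

≋-refl : ∀ {C} → C ≋ C
≋-refl = (λ _ l∈C → l∈C) , (λ _ l∈C → l∈C)

≋-sym : ∀ {C D} → C ≋ D → D ≋ C
≋-sym (C⊆D , D⊆C) = D⊆C , C⊆D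

res : Var → Tree → Tree → Tree
res x t u = node (resolve (label t) (label u) x) x t u

label∈postorder : ∀ t → label t ∈ postorder t
label∈postorder (leaf C)       = here refl
label∈postorder (node C x t u) = ∈-++⁺ʳ (postorder t) (∈-++⁺ʳ (postorder u) (here refl))

data System : Set where
  regWRTL pool : System

rule : System → Rule
rule regWRTL = RegWRTLRule
rule pool    = PoolRule

resolution-rule : ∀ σ {A B x C} → ResRule A B x C → rule σ A B x C
resolution-rule regWRTL = inj₁
resolution-rule pool    = inj₁

Wf-mono : ∀ {R Γ E E′} t → ⟦ E ⟧ ⊆ ⟦ E′ ⟧ → Wf R Γ E t → Wf R Γ E′ t
Wf-mono (leaf C)       E⊆E′ (inj₁ axiom)              = inj₁ axiom
Wf-mono (leaf C)       E⊆E′ (inj₂ (D , D∈E , C≋D))    = inj₂ (D , E⊆E′ D∈E , C≋D)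
Wf-mono (node C x t u) E⊆E′ (inference , wf-t , wf-u) =
  inference , Wf-mono t E⊆E′ wf-t , Wf-mono u (Subset.++⁺ˡ (postorder t) E⊆E′) wf-u

Wf-axiom : ∀ σ {Γ E C} → Γ C → Wf (rule σ) Γ E (leaf C)
Wf-axiom σ ΓC = inj₁ (_ , ΓC , ≋-refl)

Wf-lemma : ∀ σ {Γ E C D} → D ∈ E → C ≋ D → Wf (rule σ) Γ E (leaf C)
Wf-lemma σ D∈E C≋D = inj₂ (_ , D∈E , C≋D)

Wf-res : ∀ σ {Γ E x t u} →
  pos x ∈ label t → neg x ∈ label u → neg x ∉ label t → pos x ∉ label u →
  Wf (rule σ) Γ E t → Wf (rule σ) Γ (E ++ postorder t) u → Wf (rule σ) Γ E (res x t u)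
Wf-res σ x∈t x̄∈u x̄∉t x∉u wf-t wf-u =
  inj₁ (resolution-rule σ (x̄∉t , x∉u , x∈t , x̄∈u , resolve-resolvent)) , wf-t , wf-u

record RegularUnder (P : Pred Var 0ℓ) (t : Tree) : Set where
  constructor regularUnder
  field regular : ∀ {used} → All P used → Regular' used t

regularUnder-leaf : ∀ {P C} → RegularUnder P (leaf C)
regularUnder-leaf = regularUnder λ _ → tt

regularUnder-node : ∀ {P C x t u} → ¬ P x →
  RegularUnder (｛ x ｝ ∪ P) t → RegularUnder (｛ x ｝ ∪ P) u → RegularUnder P (node C x t u)
regularUnder-node ¬Px (regularUnder reg-t) (regularUnder reg-u) = regularUnder λ Pused →
  let Pused′ = inj₁ refl ∷ All.map inj₂ Pused
  in (λ x∈used → ¬Px (All.lookup Pused x∈used)) , reg-t Pused′ , reg-u Pused′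

regularUnder-antimono : ∀ {P Q t} → P ⊆ Q → RegularUnder Q t → RegularUnder P t
regularUnder-antimono P⊆Q (regularUnder reg) = regularUnder λ Pused → reg (All.map P⊆Q Pused)

eliminate : ℕ → Tree → (ℕ → Tree) → ℕ → Tree
eliminate u base step zero    = base
eliminate u base step (suc k) = res (p u (suc k)) (eliminate u base step k) (step (suc k))

module _ {u : ℕ} {base : Tree} {step : ℕ → Tree} where

  private
    chain = eliminate u base step

  postorder-eliminate : ∀ k → ⟦ postorder base ⟧ ⊆ ⟦ postorder (chain k) ⟧
  postorder-eliminate zero    = λ l∈ → l∈
  postorder-eliminate (suc k) = ∈-++⁺ˡ ∘ postorder-eliminate k

  size-eliminate : ∀ {b} → (∀ k → size (step k) ≤ b) → ∀ k → size (chain k) ≤ size base + k * suc b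
  size-eliminate {b} step≤b zero    = ≤-reflexive (sym (+-identityʳ _))
  size-eliminate {b} step≤b (suc k) = begin
    suc (size (chain k) + size (step (suc k))) ≤⟨ s≤s (+-mono-≤ (size-eliminate step≤b k) (step≤b (suc k))) ⟩
    suc (size base + k * suc b + b)            ≡⟨ arith (size base) k b ⟩
    size base + suc k * suc b                  ∎
    where
    open ≤-Reasoning
    arith : ∀ a k b → suc (a + k * suc b + b) ≡ a + suc k * suc b
    arith = solve-∀

  ∈-eliminate : ∀ {l c} → l ∈ label (step c) → (∀ j → var l ≢ p u j) →
    ∀ {k} → 1 ≤ c → c ≤ k → l ∈ label (chain k)
  ∈-eliminate l∈step l∉u {zero} 1≤c c≤0 = ⊥-elim (<⇒≱ 1≤c c≤0)
  ∈-eliminate {c = c} l∈step l∉u {suc k} 1≤c c≤1+k with m≤n⇒m<n∨m≡n c≤1+k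
  ... | inj₁ c<1+k = ∈-resolve⁺ˡ (∈-eliminate l∈step l∉u 1≤c (≤-pred c<1+k)) (l∉u _ ∘ cong var)
  ... | inj₂ refl  = ∈-resolve⁺ʳ l∈step (l∉u _ ∘ cong var)

OnVertex : ℕ → Pred Var 0ℓ
OnVertex u (p w _) = w ≡ u
OnVertex u (r _)   = ⊥

module _ (m : ℕ) where

  anotherStone : 2 ≤ m → ∀ s → ∃[ c ] (c ≢ s × 1 ≤ c × c ≤ m)
  anotherStone 2≤m s with s ≟ 1
  ... | yes refl = 2 , (λ ()) , s≤s z≤n , 2≤m
  ... | no s≢1   = 1 , (s≢1 ∘ sym) , ≤-refl , <⇒≤ 2≤m

  coverClause : ℕ → Clause
  coverClause u = map (λ j → pos (p u j)) (stones m)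

  CoverAbove : ℕ → ℕ → Pred Lit 0ℓ
  CoverAbove u k l = ∃[ j ] (k < j × j ≤ m × l ≡ pos (p u j))

  coverClause-⊆ : ∀ u → ⟦ coverClause u ⟧ ⊆ CoverAbove u 0
  coverClause-⊆ u l∈cover with ∈-map⁻ (λ j → pos (p u j)) l∈cover
  ... | _ , j∈stones , refl with ∈-map⁻ suc j∈stones
  ... | i , i∈upTo , refl = suc i , s≤s z≤n , ∈-upTo⁻ i∈upTo , refl

  ∈-coverClause : ∀ u {j} → 1 ≤ j → j ≤ m → pos (p u j) ∈ coverClause u
  ∈-coverClause u {suc i} _ j≤m = ∈-map⁺ (λ j → pos (p u j)) (∈-map⁺ suc (∈-upTo⁺ j≤m))

  regular-eliminate : ∀ {P u base step} → (∀ j → ¬ P (p u j)) →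
    RegularUnder (P ∪ OnVertex u) base →
    (∀ {k} → 1 ≤ k → k ≤ m → RegularUnder (P ∪ OnVertex u) (step k)) →
    ∀ {k} → k ≤ m → RegularUnder P (eliminate u base step k)
  regular-eliminate {P} {u} {base} {step} ¬Pu reg-base reg-step k≤m = regularUnder-antimono inj₁ (above k≤m)
    where
    OnVertexAbove : ℕ → Pred Var 0ℓ
    OnVertexAbove k (p w j) = w ≡ u × k < j
    OnVertexAbove k (r _)   = ⊥

    ⊆OnVertex : ∀ {k} → P ∪ OnVertexAbove k ⊆ P ∪ OnVertex u
    ⊆OnVertex {x = p w j} (inj₂ (w≡u , _)) = inj₂ w≡u
    ⊆OnVertex (inj₁ Py) = inj₁ Py

    above : ∀ {k} → k ≤ m → RegularUnder (P ∪ OnVertexAbove k) (eliminate u base step k)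
    above {zero}  _     = regularUnder-antimono ⊆OnVertex reg-base
    above {suc k} 1+k≤m =
      regularUnder-node fresh (regularUnder-antimono shift (above (<⇒≤ 1+k≤m)))
        (regularUnder-antimono toStep (reg-step (s≤s z≤n) 1+k≤m))
      where
      fresh : ¬ (P ∪ OnVertexAbove (suc k)) (p u (suc k))
      fresh (inj₁ Pu)       = ¬Pu _ Pu
      fresh (inj₂ (_ , lt)) = <-irrefl refl lt
      shift : ｛ p u (suc k) ｝ ∪ (P ∪ OnVertexAbove (suc k)) ⊆ P ∪ OnVertexAbove k
      shift (inj₁ refl)                        = inj₂ (refl , ≤-refl)
      shift (inj₂ (inj₁ Py))                   = inj₁ Py
      shift {p w j} (inj₂ (inj₂ (w≡u , 1+k<j))) = inj₂ (w≡u , <⇒≤ 1+k<j)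
      toStep : ｛ p u (suc k) ｝ ∪ (P ∪ OnVertexAbove (suc k)) ⊆ P ∪ OnVertex u
      toStep (inj₁ refl) = inj₂ refl
      toStep (inj₂ Q)    = ⊆OnVertex Q

  module _ {u : ℕ} {base : Tree} {step : ℕ → Tree} {C : Clause}
    (C-avoids-u : ∀ {l j} → l ∈ C → var l ≢ p u j)
    (base-⊆ : ⟦ label base ⟧ ⊆ CoverAbove u 0 ∪ ⟦ C ⟧)
    (step-⊆ : ∀ {k} → 1 ≤ k → k ≤ m → ⟦ label (step k) ⟧ ⊆ ⟦ neg (p u k) ∷ C ⟧) where

    private
      chain = eliminate u base step

    eliminate-⊆ : ∀ {k} → k ≤ m → ⟦ label (chain k) ⟧ ⊆ CoverAbove u k ∪ ⟦ C ⟧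
    eliminate-⊆ {zero}  _     = base-⊆
    eliminate-⊆ {suc k} 1+k≤m = resolve-⊆ fromChain fromStep
      where
      fromChain : ∀ {l} → l ∈ label (chain k) → l ≢ pos (p u (suc k)) → (CoverAbove u (suc k) ∪ ⟦ C ⟧) l
      fromChain l∈chain l≢x with eliminate-⊆ (<⇒≤ 1+k≤m) l∈chain
      ... | inj₂ l∈C = inj₂ l∈C
      ... | inj₁ (j , k<j , j≤m , refl) with m≤n⇒m<n∨m≡n k<j
      ...   | inj₁ 1+k<j = inj₁ (j , 1+k<j , j≤m , refl)
      ...   | inj₂ refl  = ⊥-elim (l≢x refl)
      fromStep : ∀ {l} → l ∈ label (step (suc k)) → l ≢ neg (p u (suc k)) → (CoverAbove u (suc k) ∪ ⟦ C ⟧) l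
      fromStep l∈step l≢x̄ with step-⊆ (s≤s z≤n) 1+k≤m l∈step
      ... | here refl = ⊥-elim (l≢x̄ refl)
      ... | there l∈C = inj₂ l∈C

    eliminate-all-⊆ : ⟦ label (chain m) ⟧ ⊆ ⟦ C ⟧
    eliminate-all-⊆ l∈chain with eliminate-⊆ ≤-refl l∈chain
    ... | inj₁ (j , m<j , j≤m , _) = ⊥-elim (<⇒≱ m<j j≤m)
    ... | inj₂ l∈C                 = l∈C

    module _ (base-cover : ∀ {j} → 1 ≤ j → j ≤ m → pos (p u j) ∈ label base) where

      ∈-eliminate-cover : ∀ {k j} → k < j → j ≤ m → pos (p u j) ∈ label (chain k)
      ∈-eliminate-cover {zero}  = base-cover
      ∈-eliminate-cover {suc k} 1+k<j j≤m =
        ∈-resolve⁺ˡ (∈-eliminate-cover (<⇒≤ 1+k<j) j≤m) λ { refl → <-irrefl refl 1+k<j }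

      Wf-eliminate : ∀ σ {Γ E} → Wf (rule σ) Γ E base →
        (∀ {E′ k} → ⟦ E ++ postorder base ⟧ ⊆ ⟦ E′ ⟧ → 1 ≤ k → k ≤ m → Wf (rule σ) Γ E′ (step k)) →
        (∀ {k} → 1 ≤ k → k ≤ m → neg (p u k) ∈ label (step k)) →
        ∀ {k} → k ≤ m → Wf (rule σ) Γ E (chain k)
      Wf-eliminate σ wf-base wf-step x̄∈step {zero}  _     = wf-base
      Wf-eliminate σ {E = E} wf-base wf-step x̄∈step {suc k} 1+k≤m =
        Wf-res σ (∈-eliminate-cover ≤-refl 1+k≤m) (x̄∈step (s≤s z≤n) 1+k≤m) x̄∉chain x∉step
          (Wf-eliminate σ wf-base wf-step x̄∈step (<⇒≤ 1+k≤m))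
          (wf-step (Subset.++⁺ʳ E (postorder-eliminate k)) (s≤s z≤n) 1+k≤m)
        where
        x̄∉chain : neg (p u (suc k)) ∉ label (chain k)
        x̄∉chain x̄∈chain with eliminate-⊆ (<⇒≤ 1+k≤m) x̄∈chain
        ... | inj₁ (_ , _ , _ , ())
        ... | inj₂ x̄∈C = C-avoids-u x̄∈C refl
        x∉step : pos (p u (suc k)) ∉ label (step (suc k))
        x∉step x∈step with step-⊆ (s≤s z≤n) 1+k≤m x∈step
        ... | there x∈C = C-avoids-u x∈C refl

-- `splice σ x y B d g` hangs the derivation d of x̄ ∨ y below g: d is combined with the axiom B
-- on y, and the result with g on x.  Both steps are w-resolutions (regWRTL) or degenerate
-- resolutions (pool); if g derives B then so does the spliced tree, up to ≋, and the clause of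
-- d is a lemma for everything right of it in postorder.
spliceInner : System → Var → Clause → Clause → Clause
spliceInner regWRTL y B D = resolve D B y
spliceInner pool    y B D = B

spliceOuter : System → Var → Clause → Clause → Clause
spliceOuter regWRTL x I G = resolve G I x
spliceOuter pool    x I G = G

opaque
  splice : System → Var → Var → Clause → Tree → Tree → Tree
  splice σ x y B d g =
    node (spliceOuter σ x (spliceInner σ y B (label d)) (label g)) x g
         (node (spliceInner σ y B (label d)) y d (leaf B))

module _ {x y : Var} {B : Clause} {d g : Tree}
  (x≢y : x ≢ y) (B-avoids : ∀ {l} → l ∈ B → var l ≢ x × var l ≢ y)
  (d≋ : label d ≋ (neg x ∷ pos y ∷ [])) (g≋ : label g ≋ B) where

  private
    inner : System → Clause
    inner σ = spliceInner σ y B (label d)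

    ∉B : ∀ {l} → var l ≡ x ⊎ var l ≡ y → l ∉ B
    ∉B (inj₁ refl) l∈B = proj₁ (B-avoids l∈B) refl
    ∉B (inj₂ refl) l∈B = proj₂ (B-avoids l∈B) refl

    ∉g : ∀ {l} → var l ≡ x → l ∉ label g
    ∉g l∈x l∈g = ∉B (inj₁ l∈x) (proj₁ g≋ _ l∈g)

    ȳ∉d : neg y ∉ label d
    ȳ∉d ȳ∈d with proj₁ d≋ _ ȳ∈d
    ... | here refl = x≢y refl
    ... | there (here ())

    y∈d : pos y ∈ label d
    y∈d = proj₂ d≋ _ (there (here refl))

    inner-⊆ : ∀ σ → ⟦ inner σ ⟧ ⊆ ⟦ B ⟧ ∪ ｛ neg x ｝
    inner-⊆ pool    = inj₁
    inner-⊆ regWRTL = resolve-⊆ fromD (λ l∈B _ → inj₁ l∈B)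
      where
      fromD : ∀ {l} → l ∈ label d → l ≢ pos y → (⟦ B ⟧ ∪ ｛ neg x ｝) l
      fromD l∈d l≢y with proj₁ d≋ _ l∈d
      ... | here refl         = inj₂ refl
      ... | there (here refl) = ⊥-elim (l≢y refl)

    x∉inner : ∀ σ → pos x ∉ inner σ
    x∉inner σ x∈inner with inner-⊆ σ x∈inner
    ... | inj₁ x∈B = ∉B (inj₁ refl) x∈B

  opaque
    unfolding splice

    splice-≋ : ∀ σ → label (splice σ x y B d g) ≋ B
    splice-≋ pool    = g≋
    splice-≋ regWRTL =
      (λ _ → spliced⊆B) , λ l l∈B → ∈-resolve⁺ˡ (proj₂ g≋ l l∈B) λ l≡x → ∉B (inj₁ (cong var l≡x)) l∈B
      where
      spliced⊆B : ⟦ label (splice regWRTL x y B d g) ⟧ ⊆ ⟦ B ⟧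
      spliced⊆B = resolve-⊆ (λ l∈g _ → proj₁ g≋ _ l∈g) λ l∈inner l≢x̄ →
        [ (λ l∈B → l∈B) , (λ x̄≡l → ⊥-elim (l≢x̄ (sym x̄≡l))) ] (inner-⊆ regWRTL l∈inner)

    Wf-splice : ∀ σ {Γ E} → Γ B → Wf (rule σ) Γ E g → Wf (rule σ) Γ (E ++ postorder g) d →
      Wf (rule σ) Γ E (splice σ x y B d g)
    Wf-splice σ ΓB wf-g wf-d = inj₁ (outer-rule σ) , wf-g , inj₁ (inner-rule σ) , wf-d , Wf-axiom σ ΓB
      where
      outer-rule : ∀ σ → rule σ (label g) (inner σ) x (label (splice σ x y B d g))
      outer-rule regWRTL = inj₂ (∉g refl , x∉inner regWRTL , resolve-resolvent)
      outer-rule pool    =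
        inj₂ (∉g refl , ∉B (inj₁ refl) , inj₂ (inj₂ (inj₂ (∉g refl , ∉B (inj₁ refl) , inj₁ ≋-refl))))
      inner-rule : ∀ σ → rule σ (label d) B y (inner σ)
      inner-rule regWRTL = inj₂ (ȳ∉d , ∉B (inj₂ refl) , resolve-resolvent)
      inner-rule pool    = inj₂ (ȳ∉d , ∉B (inj₂ refl) , inj₂ (inj₁ (y∈d , ∉B (inj₂ refl) , ≋-refl)))

module _ {σ : System} {x y : Var} {B : Clause} {d g : Tree} where

  opaque
    unfolding splice

    regular-splice : ∀ {P} → x ≢ y → ¬ P x → ¬ P y →
      RegularUnder (｛ x ｝ ∪ P) g → RegularUnder (｛ y ｝ ∪ (｛ x ｝ ∪ P)) d →
      RegularUnder P (splice σ x y B d g)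
    regular-splice x≢y ¬Px ¬Py reg-g reg-d =
      regularUnder-node ¬Px reg-g (regularUnder-node [ x≢y , ¬Py ] reg-d regularUnder-leaf)

    postorder-splice : ⟦ postorder g ⟧ ⊆ ⟦ postorder (splice σ x y B d g) ⟧
    postorder-splice = ∈-++⁺ˡ

    label∈postorder-splice : label d ∈ postorder (splice σ x y B d g)
    label∈postorder-splice = ∈-++⁺ʳ (postorder g) (∈-++⁺ˡ (∈-++⁺ˡ (label∈postorder d)))

    size-splice : size (splice σ x y B d g) ≡ 3 + (size g + size d)
    size-splice = arith (size g) (size d)
      where
      arith : ∀ a b → suc (a + suc (b + 1)) ≡ 3 + (a + b)
      arith = solve-∀

1+[n∸1]*x+x≡1+n*x : ∀ {n} x → 1 ≤ n → 1 + (n ∸ 1) * x + x ≡ 1 + n * x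
1+[n∸1]*x+x≡1+n*x {suc n} x _ = arith n x
  where
  arith : ∀ n x → 1 + n * x + x ≡ 1 + suc n * x
  arith = solve-∀

cubic-bound : ∀ {N m} → 1 ≤ N → 1 ≤ m → 1 + N * (m * (3 + (1 + m * (4 + m * 4)))) ≤ 13 * N * m ^ 3
cubic-bound {suc M} {suc k} _ _ = ≤-trans (m≤m+n _ _) (≤-reflexive (arith M k))
  where
  arith : ∀ M k → 1 + suc M * (suc k * (3 + (1 + suc k * (4 + suc k * 4))))
                    + (suc M * (9 * (k * k * k) + 23 * (k * k) + 15 * k) + M)
                  ≡ 13 * suc M * (suc k * (suc k * (suc k * 1)))
  arith = solve-∀

module StoneRefutation (G : StoneDag) (m : ℕ) (N≤m : N G ≤ m) (σ : System) where

  private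
    R = rule σ
    Γ = Stone G m
    1≤m : 1 ≤ m
    1≤m = ≤-trans (1≤N G) N≤m

  -- An axiom (2) when u is a source, and the lemma derived for every other vertex.
  redIfPebbled : ℕ → ℕ → Clause
  redIfPebbled u j = neg (p u j) ∷ pos (r j) ∷ []

  pebbleClause : ℕ → ℕ → ℕ → ℕ → Clause
  pebbleClause v s k c = neg (p (pred₁ G v) k) ∷ neg (r k) ∷ neg (p (pred₂ G v) c) ∷ neg (r c) ∷
                         neg (p v s) ∷ pos (r s) ∷ []

  sinkClause : ℕ → Clause
  sinkClause j = neg (p 1 j) ∷ neg (r j) ∷ []

  r̄∉redIfPebbled : ∀ {u j k} → neg (r k) ∉ redIfPebbled u j
  r̄∉redIfPebbled (here ())
  r̄∉redIfPebbled (there (here ()))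

  -- The lemmas p̄ᵤⱼ ∨ rⱼ

  -- Derives a subclause of p̄_{v₁,k} ∨ p̄_{v₂,c} ∨ r̄_c ∨ p̄_{v,s} ∨ r_s.  A pebbling clause needs
  -- stones different from s; for k = s the lemma for v₁ serves instead, and for k = c the
  -- pebbling clause itself has the required form.
  pred₁Step : (v s c k : ℕ) → Tree
  pred₁Step v s c k with k ≟ s | k ≟ c
  ... | yes _ | _     = leaf (redIfPebbled (pred₁ G v) k)
  ... | no _  | yes _ = leaf (pebbleClause v s k k)
  ... | no _  | no _  = res (r k) (leaf (redIfPebbled (pred₁ G v) k)) (leaf (pebbleClause v s k c))

  redGivenPred₂ : (v s c : ℕ) → Tree
  redGivenPred₂ v s c = eliminate (pred₁ G v) (leaf (coverClause m (pred₁ G v))) (pred₁Step v s c) m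

  pred₂Step : (v s c : ℕ) → Tree
  pred₂Step v s c with c ≟ s
  ... | yes _ = leaf (redIfPebbled (pred₂ G v) s)
  ... | no _  = res (r c) (leaf (redIfPebbled (pred₂ G v) c)) (redGivenPred₂ v s c)

  deriveRed : (v s : ℕ) → Tree
  deriveRed v s = eliminate (pred₂ G v) (leaf (coverClause m (pred₂ G v))) (pred₂Step v s) m

  lemmaSize : ℕ
  lemmaSize = 1 + m * (4 + m * 4)

  pred₁Step-size : ∀ v s c k → size (pred₁Step v s c k) ≤ 3
  pred₁Step-size v s c k with k ≟ s | k ≟ c
  ... | yes _ | _     = s≤s z≤n
  ... | no _  | yes _ = s≤s z≤n
  ... | no _  | no _  = ≤-refl

  pred₂Step-size : ∀ v s c → size (pred₂Step v s c) ≤ 3 + m * 4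
  pred₂Step-size v s c with c ≟ s
  ... | yes _ = s≤s z≤n
  ... | no _  = s≤s (s≤s (size-eliminate (pred₁Step-size v s c) m))

  deriveRed-size : ∀ v s → size (deriveRed v s) ≤ lemmaSize
  deriveRed-size v s = size-eliminate (pred₂Step-size v s) m

  RedLemmas : List Clause → ℕ → Set
  RedLemmas E u = ∀ {t} → 1 ≤ t → t ≤ m → Wf R Γ E (leaf (redIfPebbled u t))

  LemmasAbove : List Clause → ℕ → Set
  LemmasAbove E v = ∀ {u} → v < u → u ≤ N G → RedLemmas E u

  LemmasAbove-mono : ∀ {E E′ v} → ⟦ E ⟧ ⊆ ⟦ E′ ⟧ → LemmasAbove E v → LemmasAbove E′ v
  LemmasAbove-mono E⊆E′ above v<u u≤N 1≤t t≤m = Wf-mono {R = R} (leaf _) E⊆E′ (above v<u u≤N 1≤t t≤m)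

  sourceLemmas : ∀ {E u} → n G < u → u ≤ N G → RedLemmas E u
  sourceLemmas n<u u≤N 1≤t t≤m = Wf-axiom σ (source _ _ n<u u≤N 1≤t t≤m)

  AtMost : ℕ → Pred Var 0ℓ
  AtMost a (p u _) = u ≤ a
  AtMost a (r _)   = ⊥

  module DeriveRed {v s : ℕ} (1≤v : 1 ≤ v) (v≤n : v ≤ n G) (1≤s : 1 ≤ s) (s≤m : s ≤ m) where

    private
      v₁ = pred₁ G v
      v₂ = pred₂ G v
      v<v₁ : v < v₁
      v<v₁ = proj₁ (pred₁-ok G v 1≤v v≤n)
      v<v₂ : v < v₂
      v<v₂ = proj₁ (pred₂-ok G v 1≤v v≤n)
      v₁≢v₂ : v₁ ≢ v₂
      v₁≢v₂ = pred-distinct G v 1≤v v≤n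
      v₁≤N : v₁ ≤ N G
      v₁≤N = proj₂ (pred₁-ok G v 1≤v v≤n)
      v₂≤N : v₂ ≤ N G
      v₂≤N = proj₂ (pred₂-ok G v 1≤v v≤n)

    given₂ : ℕ → Clause
    given₂ c = neg (p v₂ c) ∷ neg (r c) ∷ redIfPebbled v s

    pred₁Step-⊆ : ∀ c k → ⟦ label (pred₁Step v s c k) ⟧ ⊆ ⟦ neg (p v₁ k) ∷ given₂ c ⟧
    pred₁Step-⊆ c k with k ≟ s | k ≟ c
    ... | yes refl | _        = λ
      { (here refl)         → here refl
      ; (there (here refl)) → there (there (there (there (here refl))))
      }
    ... | no _     | yes refl = λ
      { (here refl)                                         → here refl
      ; (there (here refl))                                 → there (there (here refl))
      ; (there (there (here refl)))                         → there (here refl)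
      ; (there (there (there (here refl))))                 → there (there (here refl))
      ; (there (there (there (there (here refl)))))         → there (there (there (here refl)))
      ; (there (there (there (there (there (here refl)))))) → there (there (there (there (here refl))))
      }
    ... | no _     | no _   = resolve-⊆ {P = ⟦ neg (p v₁ k) ∷ given₂ c ⟧}
      (λ { (here refl) _ → here refl ; (there (here refl)) r≢r → ⊥-elim (r≢r refl) })
      (λ { (here refl)                                         _ → here refl
         ; (there (here refl))                                 r̄≢r̄ → ⊥-elim (r̄≢r̄ refl)
         ; (there (there (here refl)))                         _ → there (here refl)
         ; (there (there (there (here refl))))                 _ → there (there (here refl))
         ; (there (there (there (there (here refl)))))         _ → there (there (there (here refl)))
         ; (there (there (there (there (there (here refl)))))) _ → there (there (there (there (here refl))))
         })

    pred₁Step-∋ : ∀ c k → neg (p v₁ k) ∈ label (pred₁Step v s c k)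
    pred₁Step-∋ c k with k ≟ s | k ≟ c
    ... | yes _ | _     = here refl
    ... | no _  | yes _ = here refl
    ... | no _  | no _  = ∈-resolve⁺ˡ (here refl) (λ ())

    pred₁Step-∋-given₂ : ∀ {c} → c ≢ s →
      neg (r c) ∈ label (pred₁Step v s c c) × neg (p v s) ∈ label (pred₁Step v s c c)
    pred₁Step-∋-given₂ {c} c≢s with c ≟ s | c ≟ c
    ... | yes c≡s | _      = ⊥-elim (c≢s c≡s)
    ... | no _    | yes _  = there (here refl) , there (there (there (there (here refl))))
    ... | no _    | no c≢c = ⊥-elim (c≢c refl)

    given₂-avoids-v₁ : ∀ c {l j} → l ∈ given₂ c → var l ≢ p v₁ j
    given₂-avoids-v₁ c (here refl)                         = v₁≢v₂ ∘ sym ∘ vertex-injective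
    given₂-avoids-v₁ c (there (here refl))                 = λ ()
    given₂-avoids-v₁ c (there (there (here refl)))         = <⇒≢ v<v₁ ∘ vertex-injective
    given₂-avoids-v₁ c (there (there (there (here refl)))) = λ ()

    redGivenPred₂-⊆ : ∀ c → ⟦ label (redGivenPred₂ v s c) ⟧ ⊆ ⟦ given₂ c ⟧
    redGivenPred₂-⊆ c =
      eliminate-all-⊆ m (given₂-avoids-v₁ c) (inj₁ ∘ coverClause-⊆ m v₁) (λ _ _ → pred₁Step-⊆ c _)

    redGivenPred₂-∋ : ∀ {c} → c ≢ s → 1 ≤ c → c ≤ m →
      neg (r c) ∈ label (redGivenPred₂ v s c) × neg (p v s) ∈ label (redGivenPred₂ v s c)
    redGivenPred₂-∋ c≢s 1≤c c≤m =
      ∈-eliminate (proj₁ (pred₁Step-∋-given₂ c≢s)) (λ _ ()) 1≤c c≤m ,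
      ∈-eliminate (proj₂ (pred₁Step-∋-given₂ c≢s)) (λ _ → <⇒≢ v<v₁ ∘ vertex-injective) 1≤c c≤m

    pred₂Step-⊆ : ∀ c → ⟦ label (pred₂Step v s c) ⟧ ⊆ ⟦ neg (p v₂ c) ∷ redIfPebbled v s ⟧
    pred₂Step-⊆ c with c ≟ s
    ... | yes refl = λ { (here refl) → here refl ; (there (here refl)) → there (there (here refl)) }
    ... | no _     = resolve-⊆ {P = ⟦ neg (p v₂ c) ∷ redIfPebbled v s ⟧}
      (λ { (here refl) _ → here refl ; (there (here refl)) r≢r → ⊥-elim (r≢r refl) }) fromGiven₂
      where
      fromGiven₂ : ∀ {l} → l ∈ label (redGivenPred₂ v s c) → l ≢ neg (r c) →
                   l ∈ neg (p v₂ c) ∷ redIfPebbled v s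
      fromGiven₂ l∈ l≢r̄ with redGivenPred₂-⊆ c l∈
      ... | here refl           = here refl
      ... | there (here refl)   = ⊥-elim (l≢r̄ refl)
      ... | there (there l∈red) = there l∈red

    pred₂Step-∋ : ∀ c → neg (p v₂ c) ∈ label (pred₂Step v s c)
    pred₂Step-∋ c with c ≟ s
    ... | yes refl = here refl
    ... | no _     = ∈-resolve⁺ˡ (here refl) (λ ())

    pred₂Step-∋-red : pos (r s) ∈ label (pred₂Step v s s)
    pred₂Step-∋-red with s ≟ s
    ... | yes _  = there (here refl)
    ... | no s≢s = ⊥-elim (s≢s refl)

    pred₂Step-∋-pebbled : ∀ {c} → c ≢ s → 1 ≤ c → c ≤ m → neg (p v s) ∈ label (pred₂Step v s c)
    pred₂Step-∋-pebbled {c} c≢s 1≤c c≤m with c ≟ s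
    ... | yes c≡s = ⊥-elim (c≢s c≡s)
    ... | no _    = ∈-resolve⁺ʳ (proj₂ (redGivenPred₂-∋ c≢s 1≤c c≤m)) (λ ())

    red-avoids-v₂ : ∀ {l j} → l ∈ redIfPebbled v s → var l ≢ p v₂ j
    red-avoids-v₂ (here refl)         = <⇒≢ v<v₂ ∘ vertex-injective
    red-avoids-v₂ (there (here refl)) = λ ()

    deriveRed-≋ : label (deriveRed v s) ≋ redIfPebbled v s
    deriveRed-≋ =
      (λ _ → eliminate-all-⊆ m red-avoids-v₂ (inj₁ ∘ coverClause-⊆ m v₂) (λ _ _ → pred₂Step-⊆ _)) , ⊇red
      where
      2≤m : 2 ≤ m
      2≤m = ≤-trans (≤-<-trans 1≤v v<v₁) (≤-trans v₁≤N N≤m)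
      ⊇red : ∀ l → l ∈ redIfPebbled v s → l ∈ label (deriveRed v s)
      -- p̄ᵥₛ enters through the branch of any stone c ≠ s.
      ⊇red _ (here refl) with anotherStone m 2≤m s
      ... | c , c≢s , 1≤c , c≤m =
        ∈-eliminate (pred₂Step-∋-pebbled c≢s 1≤c c≤m) (λ _ → <⇒≢ v<v₂ ∘ vertex-injective) 1≤c c≤m
      ⊇red _ (there (here refl)) = ∈-eliminate pred₂Step-∋-red (λ _ ()) 1≤s s≤m

    pred₁Step-wf : ∀ {E c k} → LemmasAbove E v → c ≢ s → 1 ≤ c → c ≤ m → 1 ≤ k → k ≤ m →
      Wf R Γ E (pred₁Step v s c k)
    pred₁Step-wf {c = c} {k} above c≢s 1≤c c≤m 1≤k k≤m with k ≟ s | k ≟ c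
    ... | yes refl | _        = above v<v₁ v₁≤N 1≤k k≤m
    ... | no k≢s   | yes refl =
      Wf-axiom σ (pebble v s k k 1≤v v≤n 1≤s s≤m 1≤k k≤m 1≤k k≤m (k≢s ∘ sym) (k≢s ∘ sym))
    ... | no k≢s   | no _     =
      Wf-res σ (there (here refl)) (there (here refl)) r̄∉redIfPebbled r∉pebble
        (above v<v₁ v₁≤N 1≤k k≤m)
        (Wf-axiom σ (pebble v s k c 1≤v v≤n 1≤s s≤m 1≤k k≤m 1≤c c≤m (k≢s ∘ sym) (c≢s ∘ sym)))
      where
      r∉pebble : pos (r k) ∉ pebbleClause v s k c
      r∉pebble (there (there (there (there (there (here refl)))))) = k≢s refl

    redGivenPred₂-wf : ∀ {E c} → LemmasAbove E v → c ≢ s → 1 ≤ c → c ≤ m → Wf R Γ E (redGivenPred₂ v s c)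
    redGivenPred₂-wf {c = c} above c≢s 1≤c c≤m =
      Wf-eliminate m (given₂-avoids-v₁ c) (inj₁ ∘ coverClause-⊆ m v₁) (λ _ _ → pred₁Step-⊆ c _)
        (∈-coverClause m v₁) σ
        (Wf-axiom σ (cover v₁ (≤-trans 1≤v (<⇒≤ v<v₁)) v₁≤N))
        (λ E⊆E′ → pred₁Step-wf (LemmasAbove-mono (E⊆E′ ∘ ∈-++⁺ˡ) above) c≢s 1≤c c≤m)
        (λ _ _ → pred₁Step-∋ c _) ≤-refl

    pred₂Step-wf : ∀ {E c} → LemmasAbove E v → 1 ≤ c → c ≤ m → Wf R Γ E (pred₂Step v s c)
    pred₂Step-wf {c = c} above 1≤c c≤m with c ≟ s
    ... | yes refl = above v<v₂ v₂≤N 1≤c c≤m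
    ... | no c≢s   =
      Wf-res σ (there (here refl)) (proj₁ (redGivenPred₂-∋ c≢s 1≤c c≤m)) r̄∉redIfPebbled r∉given
        (above v<v₂ v₂≤N 1≤c c≤m)
        (redGivenPred₂-wf (LemmasAbove-mono ∈-++⁺ˡ above) c≢s 1≤c c≤m)
      where
      r∉given : pos (r c) ∉ label (redGivenPred₂ v s c)
      r∉given r∈given with redGivenPred₂-⊆ c r∈given
      ... | there (there (there (here refl))) = c≢s refl

    deriveRed-wf : ∀ {E} → LemmasAbove E v → Wf R Γ E (deriveRed v s)
    deriveRed-wf above =
      Wf-eliminate m red-avoids-v₂ (inj₁ ∘ coverClause-⊆ m v₂) (λ _ _ → pred₂Step-⊆ _)
        (∈-coverClause m v₂) σ
        (Wf-axiom σ (cover v₂ (≤-trans 1≤v (<⇒≤ v<v₂)) v₂≤N))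
        (λ E⊆E′ → pred₂Step-wf (LemmasAbove-mono (E⊆E′ ∘ ∈-++⁺ˡ) above))
        (λ _ _ → pred₂Step-∋ _) ≤-refl

    private
      AboveDeriveRed AbovePred₂Step : Pred Var 0ℓ
      AboveDeriveRed = AtMost v ∪ ｛ r s ｝
      AbovePred₂Step = AboveDeriveRed ∪ OnVertex v₂
      AbovePred₁Step : ℕ → Pred Var 0ℓ
      AbovePred₁Step c = (｛ r c ｝ ∪ AbovePred₂Step) ∪ OnVertex v₁

    pred₁Step-regular : ∀ c k → RegularUnder (AbovePred₁Step c) (pred₁Step v s c k)
    pred₁Step-regular c k with k ≟ s | k ≟ c
    ... | yes _  | _      = regularUnder-leaf
    ... | no _   | yes _  = regularUnder-leaf
    ... | no k≢s | no k≢c = regularUnder-node fresh regularUnder-leaf regularUnder-leaf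
      where
      fresh : ¬ AbovePred₁Step c (r k)
      fresh (inj₁ (inj₁ refl))               = k≢c refl
      fresh (inj₁ (inj₂ (inj₁ (inj₁ ()))))
      fresh (inj₁ (inj₂ (inj₁ (inj₂ refl)))) = k≢s refl
      fresh (inj₁ (inj₂ (inj₂ ())))
      fresh (inj₂ ())

    redGivenPred₂-regular : ∀ c → RegularUnder (｛ r c ｝ ∪ AbovePred₂Step) (redGivenPred₂ v s c)
    redGivenPred₂-regular c = regular-eliminate m fresh regularUnder-leaf (λ _ _ → pred₁Step-regular c _) ≤-refl
      where
      fresh : ∀ j → ¬ (｛ r c ｝ ∪ AbovePred₂Step) (p v₁ j)
      fresh j (inj₁ ())
      fresh j (inj₂ (inj₁ (inj₁ v₁≤v))) = <⇒≱ v<v₁ v₁≤v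
      fresh j (inj₂ (inj₁ (inj₂ ())))
      fresh j (inj₂ (inj₂ v₁≡v₂))       = v₁≢v₂ v₁≡v₂

    pred₂Step-regular : ∀ c → RegularUnder AbovePred₂Step (pred₂Step v s c)
    pred₂Step-regular c with c ≟ s
    ... | yes _  = regularUnder-leaf
    ... | no c≢s = regularUnder-node fresh regularUnder-leaf (redGivenPred₂-regular c)
      where
      fresh : ¬ AbovePred₂Step (r c)
      fresh (inj₁ (inj₁ ()))
      fresh (inj₁ (inj₂ refl)) = c≢s refl
      fresh (inj₂ ())

    deriveRed-regular : RegularUnder AboveDeriveRed (deriveRed v s)
    deriveRed-regular = regular-eliminate m fresh regularUnder-leaf (λ _ _ → pred₂Step-regular _) ≤-refl
      where
      fresh : ∀ j → ¬ AboveDeriveRed (p v₂ j)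
      fresh j (inj₁ v₂≤v) = <⇒≱ v<v₂ v₂≤v
      fresh j (inj₂ ())

  record RedDerivation (v s : ℕ) (t : Tree) : Set where
    field
      wf      : ∀ {E} → LemmasAbove E v → Wf R Γ E t
      label≋  : label t ≋ redIfPebbled v s
      regular : RegularUnder (AtMost v ∪ ｛ r s ｝) t

  redTree : ℕ → ℕ → Tree
  redTree v s with v ≤? n G
  ... | yes _ = deriveRed v s
  ... | no _  = leaf (redIfPebbled v s)

  redTree-derivation : ∀ {v s} → 1 ≤ v → v ≤ N G → 1 ≤ s → s ≤ m → RedDerivation v s (redTree v s)
  redTree-derivation {v} {s} 1≤v v≤N 1≤s s≤m with v ≤? n G
  ... | yes v≤n = record { wf = deriveRed-wf ; label≋ = deriveRed-≋ ; regular = deriveRed-regular }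
    where open DeriveRed 1≤v v≤n 1≤s s≤m
  ... | no v≰n  = record
    { wf      = λ _ → Wf-axiom σ (source v s (≰⇒> v≰n) v≤N 1≤s s≤m)
    ; label≋  = ≋-refl
    ; regular = regularUnder-leaf
    }

  redTree-size : ∀ v s → size (redTree v s) ≤ lemmaSize
  redTree-size v s with v ≤? n G
  ... | yes _ = deriveRed-size v s
  ... | no _  = s≤s z≤n

  -- The spine

  spliceStones : ℕ → ℕ → Tree → Tree
  spliceStones v zero    g = g
  spliceStones v (suc t) g =
    splice σ (p v (suc t)) (r (suc t)) (coverClause m 1) (redTree v (suc t)) (spliceStones v t g)

  spliceStones-size : ∀ v t g → size (spliceStones v t g) ≤ size g + t * (3 + lemmaSize)
  spliceStones-size v zero    g = ≤-reflexive (sym (+-identityʳ _))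
  spliceStones-size v (suc t) g = begin
    size (spliceStones v (suc t) g)
      ≡⟨ size-splice ⟩
    3 + (size (spliceStones v t g) + size (redTree v (suc t)))
      ≤⟨ +-monoʳ-≤ 3 (+-mono-≤ (spliceStones-size v t g) (redTree-size v (suc t))) ⟩
    3 + (size g + t * (3 + lemmaSize) + lemmaSize)
      ≡⟨ arith (size g) t lemmaSize ⟩
    size g + suc t * (3 + lemmaSize) ∎
    where
    open ≤-Reasoning
    arith : ∀ a t l → 3 + (a + t * (3 + l) + l) ≡ a + suc t * (3 + l)
    arith = solve-∀

  postorder-spliceStones : ∀ {v g} t → ⟦ postorder g ⟧ ⊆ ⟦ postorder (spliceStones v t g) ⟧
  postorder-spliceStones zero    = λ l∈ → l∈
  postorder-spliceStones (suc t) = postorder-splice ∘ postorder-spliceStones t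

  label∈postorder-spliceStones : ∀ {v g t t′} → 1 ≤ t′ → t′ ≤ t →
    label (redTree v t′) ∈ postorder (spliceStones v t g)
  label∈postorder-spliceStones {t = zero}  1≤t′ t′≤0   = ⊥-elim (<⇒≱ 1≤t′ t′≤0)
  label∈postorder-spliceStones {t = suc t} 1≤t′ t′≤1+t with m≤n⇒m<n∨m≡n t′≤1+t
  ... | inj₁ t′<1+t = postorder-splice (label∈postorder-spliceStones 1≤t′ (≤-pred t′<1+t))
  ... | inj₂ refl   = label∈postorder-splice

  -- The resolution variables on the path from the root to `spliceStones v t g`.
  ResolvedAbove : ℕ → ℕ → Pred Var 0ℓ
  ResolvedAbove v t (p u j) = u < v ⊎ (u ≡ v × t < j)
  ResolvedAbove v t (r _)   = ⊥

  module _ {v : ℕ} (2≤v : 2 ≤ v) (v≤N : v ≤ N G) where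

    private
      1≤v : 1 ≤ v
      1≤v = <⇒≤ 2≤v

      derivation : ∀ {t} → t < m → RedDerivation v (suc t) (redTree v (suc t))
      derivation t<m = redTree-derivation 1≤v v≤N (s≤s z≤n) t<m

      cover₁-avoids : ∀ {t l} → l ∈ coverClause m 1 → var l ≢ p v t × var l ≢ r t
      cover₁-avoids l∈cover with coverClause-⊆ m 1 l∈cover
      ... | _ , _ , _ , refl = <⇒≢ 2≤v ∘ vertex-injective , λ ()

    module _ {g : Tree} (g≋ : label g ≋ coverClause m 1) where

      spliceStones-≋ : ∀ {t} → t ≤ m → label (spliceStones v t g) ≋ coverClause m 1
      spliceStones-≋ {zero}  _   = g≋
      spliceStones-≋ {suc t} t<m =
        splice-≋ (λ ()) cover₁-avoids (RedDerivation.label≋ (derivation t<m)) (spliceStones-≋ (<⇒≤ t<m)) σ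

      spliceStones-wf : ∀ {E t} → t ≤ m → Wf R Γ E g → LemmasAbove (E ++ postorder g) v →
        Wf R Γ E (spliceStones v t g)
      spliceStones-wf {t = zero}  _   wf-g above = wf-g
      spliceStones-wf {E} {suc t} t<m wf-g above =
        Wf-splice (λ ()) cover₁-avoids (RedDerivation.label≋ (derivation t<m)) (spliceStones-≋ (<⇒≤ t<m)) σ
          (cover 1 ≤-refl (1≤N G))
          (spliceStones-wf (<⇒≤ t<m) wf-g above)
          (RedDerivation.wf (derivation t<m) (LemmasAbove-mono (Subset.++⁺ʳ E (postorder-spliceStones t)) above))

      spliceStones-lemmas : ∀ {E} → RedLemmas (E ++ postorder (spliceStones v m g)) v
      spliceStones-lemmas {E} 1≤t t≤m =
        Wf-lemma σ (∈-++⁺ʳ E (label∈postorder-spliceStones 1≤t t≤m))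
          (≋-sym (RedDerivation.label≋ (redTree-derivation 1≤v v≤N 1≤t t≤m)))

    spliceStones-regular : ∀ {g t} → t ≤ m → RegularUnder (AtMost v) g →
      RegularUnder (ResolvedAbove v t) (spliceStones v t g)
    spliceStones-regular {t = zero}  _   reg-g = regularUnder-antimono resolved⇒atMost reg-g
      where
      resolved⇒atMost : ResolvedAbove v 0 ⊆ AtMost v
      resolved⇒atMost {p u j} (inj₁ u<v)       = <⇒≤ u<v
      resolved⇒atMost {p u j} (inj₂ (refl , _)) = ≤-refl
    spliceStones-regular {t = suc t} t<m reg-g =
      regular-splice (λ ()) fresh (λ ())
        (regularUnder-antimono shift (spliceStones-regular (<⇒≤ t<m) reg-g))
        (regularUnder-antimono toPath (RedDerivation.regular (derivation t<m)))
      where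
      fresh : ¬ ResolvedAbove v (suc t) (p v (suc t))
      fresh (inj₁ v<v)       = <-irrefl refl v<v
      fresh (inj₂ (_ , t<t)) = <-irrefl refl t<t
      shift : ｛ p v (suc t) ｝ ∪ ResolvedAbove v (suc t) ⊆ ResolvedAbove v t
      shift (inj₁ refl)                            = inj₂ (refl , ≤-refl)
      shift {p u j} (inj₂ (inj₁ u<v))              = inj₁ u<v
      shift {p u j} (inj₂ (inj₂ (u≡v , 1+t<j)))    = inj₂ (u≡v , <⇒≤ 1+t<j)
      toPath : ｛ r (suc t) ｝ ∪ (｛ p v (suc t) ｝ ∪ ResolvedAbove v (suc t)) ⊆ AtMost v ∪ ｛ r (suc t) ｝
      toPath (inj₁ refl)                           = inj₂ refl
      toPath (inj₂ (inj₁ refl))                    = inj₁ ≤-refl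
      toPath {p u j} (inj₂ (inj₂ (inj₁ u<v)))      = inj₁ (<⇒≤ u<v)
      toPath {p u j} (inj₂ (inj₂ (inj₂ (refl , _)))) = inj₁ ≤-refl

  -- Splices in the lemmas for the vertices a+1, …, a+d, larger vertices first (deeper, hence
  -- earlier in postorder), so the lemmas for the predecessors of a vertex precede its own.
  spineAbove : ℕ → ℕ → Tree
  spineAbove a zero    = leaf (coverClause m 1)
  spineAbove a (suc d) = spliceStones (suc a) m (spineAbove (suc a) d)

  record Spine (a : ℕ) (t : Tree) : Set where
    field
      wf      : Wf R Γ [] t
      label≋  : label t ≋ coverClause m 1
      lemmas  : LemmasAbove (postorder t) a
      regular : RegularUnder (AtMost a) t

  spineAbove-spine : ∀ {a d} → 1 ≤ a → a + d ≡ n G → Spine a (spineAbove a d)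
  spineAbove-spine {a} {zero} _ a+0≡n = record
    { wf      = Wf-axiom σ (cover 1 ≤-refl (1≤N G))
    ; label≋  = ≋-refl
    ; lemmas  = λ a<u → sourceLemmas (subst (_< _) (trans (sym (+-identityʳ a)) a+0≡n) a<u)
    ; regular = regularUnder-leaf
    }
  spineAbove-spine {a} {suc d} 1≤a a+1+d≡n = record
    { wf      = spliceStones-wf 2≤v v≤N g≋ ≤-refl (Spine.wf below) (Spine.lemmas below)
    ; label≋  = spliceStones-≋ 2≤v v≤N g≋ ≤-refl
    ; lemmas  = lemmas
    ; regular = regularUnder-antimono atMost⇒resolved (spliceStones-regular 2≤v v≤N ≤-refl (Spine.regular below))
    }
    where
    1+a+d≡n : suc a + d ≡ n G
    1+a+d≡n = trans (sym (+-suc a d)) a+1+d≡n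
    below = spineAbove-spine {suc a} {d} (s≤s z≤n) 1+a+d≡n
    g≋ = Spine.label≋ below
    2≤v : 2 ≤ suc a
    2≤v = s≤s 1≤a
    v≤N : suc a ≤ N G
    v≤N = ≤-trans (≤-trans (m≤m+n (suc a) d) (≤-reflexive 1+a+d≡n)) (n≤N G)
    lemmas : LemmasAbove (postorder (spineAbove a (suc d))) a
    lemmas a<u u≤N with m≤n⇒m<n∨m≡n a<u
    ... | inj₁ 1+a<u = LemmasAbove-mono (postorder-spliceStones m) (Spine.lemmas below) 1+a<u u≤N
    ... | inj₂ refl  = spliceStones-lemmas 2≤v v≤N g≋ {E = []}
    atMost⇒resolved : AtMost a ⊆ ResolvedAbove (suc a) m
    atMost⇒resolved {p u j} u≤a = inj₁ (s≤s u≤a)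

  spineAbove-size : ∀ a d → size (spineAbove a d) ≤ 1 + d * (m * (3 + lemmaSize))
  spineAbove-size a zero    = ≤-refl
  spineAbove-size a (suc d) = begin
    size (spliceStones (suc a) m (spineAbove (suc a) d))   ≤⟨ spliceStones-size (suc a) m _ ⟩
    size (spineAbove (suc a) d) + m * (3 + lemmaSize)      ≤⟨ +-monoˡ-≤ _ (spineAbove-size (suc a) d) ⟩
    1 + d * (m * (3 + lemmaSize)) + m * (3 + lemmaSize)    ≡⟨ arith d (m * (3 + lemmaSize)) ⟩
    1 + suc d * (m * (3 + lemmaSize))                      ∎
    where
    open ≤-Reasoning
    arith : ∀ d x → 1 + d * x + x ≡ 1 + suc d * x
    arith = solve-∀

  spine : Σ Tree λ t → Spine 1 t × size t ≤ 1 + (N G ∸ 1) * (m * (3 + lemmaSize))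
  spine with 1 ≤? n G
  ... | yes 1≤n = spineAbove 1 (n G ∸ 1) , spineAbove-spine ≤-refl (m+[n∸m]≡n 1≤n) ,
                  ≤-trans (spineAbove-size 1 (n G ∸ 1))
                          (+-monoʳ-≤ 1 (*-monoˡ-≤ _ (∸-monoˡ-≤ 1 (n≤N G))))
  ... | no n≱1  = leaf (coverClause m 1) , sourceSpine , m≤m+n 1 _
    where
    sourceSpine : Spine 1 (leaf (coverClause m 1))
    sourceSpine = record
      { wf      = Wf-axiom σ (cover 1 ≤-refl (1≤N G))
      ; label≋  = ≋-refl
      ; lemmas  = λ 1<u → sourceLemmas (<-trans (≰⇒> n≱1) 1<u)
      ; regular = regularUnder-leaf
      }

  unitStep : ℕ → Tree
  unitStep j = res (r j) (redTree 1 j) (leaf (sinkClause j))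

  unitStep-size : ∀ j → size (unitStep j) ≤ 2 + lemmaSize
  unitStep-size j = s≤s (≤-trans (+-monoˡ-≤ 1 (redTree-size 1 j)) (≤-reflexive (+-comm lemmaSize 1)))

  module _ {j : ℕ} (1≤j : 1 ≤ j) (j≤m : j ≤ m) where

    private
      open module D = RedDerivation (redTree-derivation ≤-refl (1≤N G) 1≤j j≤m)

    unitStep-⊆ : ⟦ label (unitStep j) ⟧ ⊆ ⟦ neg (p 1 j) ∷ [] ⟧
    unitStep-⊆ = resolve-⊆ fromRed fromSink
      where
      fromRed : ∀ {l} → l ∈ label (redTree 1 j) → l ≢ pos (r j) → l ∈ neg (p 1 j) ∷ []
      fromRed l∈red l≢r with proj₁ label≋ _ l∈red
      ... | here refl         = here refl
      ... | there (here refl) = ⊥-elim (l≢r refl)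
      fromSink : ∀ {l} → l ∈ sinkClause j → l ≢ neg (r j) → l ∈ neg (p 1 j) ∷ []
      fromSink (here refl)         _   = here refl
      fromSink (there (here refl)) l≢r̄ = ⊥-elim (l≢r̄ refl)

    unitStep-∋ : neg (p 1 j) ∈ label (unitStep j)
    unitStep-∋ = ∈-resolve⁺ˡ (proj₂ label≋ _ (here refl)) (λ ())

    unitStep-wf : ∀ {E} → LemmasAbove E 1 → Wf R Γ E (unitStep j)
    unitStep-wf above =
      Wf-res σ (proj₂ label≋ _ (there (here refl))) (there (here refl)) r̄∉red (λ { (here ()) ; (there (here ())) })
        (wf above) (Wf-axiom σ (sink j 1≤j j≤m))
      where
      r̄∉red : neg (r j) ∉ label (redTree 1 j)
      r̄∉red = r̄∉redIfPebbled ∘ proj₁ label≋ _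

    unitStep-regular : RegularUnder (∅ ∪ OnVertex 1) (unitStep j)
    unitStep-regular =
      regularUnder-node (λ { (inj₁ ()) ; (inj₂ ()) }) (regularUnder-antimono toPath regular) regularUnder-leaf
      where
      toPath : ｛ r j ｝ ∪ (∅ ∪ OnVertex 1) ⊆ AtMost 1 ∪ ｛ r j ｝
      toPath (inj₁ refl)               = inj₂ refl
      toPath {p u _} (inj₂ (inj₂ refl)) = inj₁ ≤-refl

  refutationTree : Tree → Tree
  refutationTree t = eliminate 1 t unitStep m

  refutationTree-size : ∀ t → size (refutationTree t) ≤ size t + m * (3 + lemmaSize)
  refutationTree-size t = size-eliminate unitStep-size m

  refutationTree-refutes : ∀ {t} → Spine 1 t → Refutation R Γ (refutationTree t)
  refutationTree-refutes {t} sp = wf , RegularUnder.regular regular [] , empty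
    where
    t⊆ : ⟦ label t ⟧ ⊆ CoverAbove m 1 0 ∪ ⟦ [] ⟧
    t⊆ = inj₁ ∘ coverClause-⊆ m 1 ∘ proj₁ (Spine.label≋ sp) _
    cover⊆t : ∀ {j} → 1 ≤ j → j ≤ m → pos (p 1 j) ∈ label t
    cover⊆t 1≤j j≤m = proj₂ (Spine.label≋ sp) _ (∈-coverClause m 1 1≤j j≤m)
    toAtMost : ∅ ∪ OnVertex 1 ⊆ AtMost 1
    toAtMost {p u _} (inj₂ refl) = ≤-refl

    wf : Wf R Γ [] (refutationTree t)
    wf = Wf-eliminate m (λ ()) t⊆ unitStep-⊆ cover⊆t σ (Spine.wf sp)
           (λ t⊆E′ 1≤j j≤m → unitStep-wf 1≤j j≤m (LemmasAbove-mono t⊆E′ (Spine.lemmas sp)))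
           unitStep-∋ ≤-refl
    regular : RegularUnder ∅ (refutationTree t)
    regular = regular-eliminate m (λ _ ()) (regularUnder-antimono toAtMost (Spine.regular sp))
                unitStep-regular ≤-refl
    empty : IsEmpty (label (refutationTree t))
    empty l l∈ with eliminate-all-⊆ m (λ ()) t⊆ unitStep-⊆ l∈
    ... | ()

  stoneRefutation : ∃[ t ] (Refutation R Γ t × size t ≤ 13 * N G * m ^ 3)
  stoneRefutation with spine
  ... | t , t-spine , t-size = refutationTree t , refutationTree-refutes t-spine , (begin
    size (refutationTree t)                 ≤⟨ refutationTree-size t ⟩
    size t + X                              ≤⟨ +-monoˡ-≤ X t-size ⟩
    1 + (N G ∸ 1) * X + X                   ≡⟨ 1+[n∸1]*x+x≡1+n*x X (1≤N G) ⟩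
    1 + N G * X                             ≤⟨ cubic-bound (1≤N G) 1≤m ⟩
    13 * N G * m ^ 3                        ∎)
    where
    open ≤-Reasoning
    X = m * (3 + lemmaSize)

theorem1p14 : ∃[ c ] ((G : StoneDag) (m : ℕ) → N G ≤ m →
    (∃[ t ] (RegWRTLRefutation (Stone G m) t × size t ≤ c * N G * m ^ 3))
    × (∃[ t ] (PoolRefutation (Stone G m) t × size t ≤ c * N G * m ^ 3)))
theorem1p14 = 13 , λ G m N≤m →
  StoneRefutation.stoneRefutation G m N≤m regWRTL , StoneRefutation.stoneRefutation G m N≤m pool
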